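{- Let $n$ be a natural number which is not a perfect square and such that $v_2(n)\geq 0$ is even. Then $D_{S(n)^*}=C_{S(n)^*}=3$.
   Context: $\mathbb Z_n=\mathbb Z/n\mathbb Z$; $S(n)^*=\{x^2:x\in\mathbb Z_n\}\setminus\{0\}$. $v_2(n)=r$ means $2^r\mid n$, $2^{r+1}\nmid n$. For $A\subseteq\mathbb Z_n$, a subsequence $T$ of a sequence $(x_1,\dots,x_k)$ in $\mathbb Z_n$, with nonempty index set $I$, is an $A$-weighted zero-sum subsequence if there exist $a_i\in A$ ($i\in I$) with $\sum_{i\in I}a_ix_i=0$. $D_{S(n)^*}$ is the least positive integer $k$ such that every sequence of length $k$ in $\mathbb Z_n$ has an $S(n)^*$-weighted zero-sum subsequence; $C_{S(n)^*}$ is the least positive integer $k$ such that every sequence of length $k$ in $\mathbb Z_n$ has an $S(n)^*$-weighted zero-sum subsequence consisting of consecutive terms. -}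

module Defs where

open import Data.Nat using (ℕ; zero; suc; _+_; _*_; _≤_; _^_)
open import Data.Nat.Divisibility using (_∣_)
open import Data.Fin using (Fin; toℕ) renaming (zero to fzero; suc to fsuc)
open import Data.Bool using (Bool; true; false; if_then_else_)
open import Data.Product using (Σ; ∃; ∃-syntax; _×_; _,_)
open import Relation.Binary.PropositionalEquality using (_≡_)
open import Relation.Nullary using (¬_)
open import Function.Bundles using (_⇔_)

-- Congruence modulo n on ℕ (elements of ℤ_n are represented by naturals).
_≡_[mod_] : ℕ → ℕ → ℕ → Set
a ≡ b [mod n ] = Σ ℕ λ p → Σ ℕ λ q → (a + p * n ≡ b + q * n)

-- a represents an element of S(n)^* = {x^2 : x ∈ ℤ_n} \ {0}
InSstar : ℕ → ℕ → Set
InSstar n a = (Σ ℕ λ y → (a ≡ y * y [mod n ])) × ¬ (a ≡ 0 [mod n ])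

sumFin : (k : ℕ) → (Fin k → ℕ) → ℕ
sumFin zero    f = 0
sumFin (suc k) f = f fzero + sumFin k (λ i → f (fsuc i))

WeightedZeroSumOn : (n k : ℕ) → (Fin k → Fin n) → (Fin k → Bool) → Set
WeightedZeroSumOn n k x I =
  (∃[ i ] (I i ≡ true)) ×
  (Σ (Fin k → ℕ) λ a → ((∀ i → I i ≡ true → InSstar n (a i)) ×
           (sumFin k (λ i → if I i then a i * toℕ (x i) else 0) ≡ 0 [mod n ])))

Consecutive : (k : ℕ) → (Fin k → Bool) → Set
Consecutive k I = Σ ℕ λ s → Σ ℕ λ e → (∀ i → (I i ≡ true) ⇔ (s ≤ toℕ i × toℕ i ≤ e))

DProp : ℕ → ℕ → Set
DProp n k = ∀ (x : Fin k → Fin n) → Σ (Fin k → Bool) λ I → WeightedZeroSumOn n k x I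

CProp : ℕ → ℕ → Set
CProp n k = ∀ (x : Fin k → Fin n) → Σ (Fin k → Bool) λ I → (Consecutive k I × WeightedZeroSumOn n k x I)

IsLeastPos : (ℕ → Set) → ℕ → Set
IsLeastPos P m = (1 ≤ m) × P m × (∀ k → 1 ≤ k → P k → m ≤ k)

D-Sstar-is : ℕ → ℕ → Set
D-Sstar-is n m = IsLeastPos (DProp n) m

C-Sstar-is : ℕ → ℕ → Set
C-Sstar-is n m = IsLeastPos (CProp n) m

IsPerfectSquare : ℕ → Set
IsPerfectSquare n = Σ ℕ λ m → (m * m ≡ n)

V2Is : ℕ → ℕ → Set
V2Is n r = (2 ^ r ∣ n) × ¬ (2 ^ suc r ∣ n)

-- Since n is not a square, n ∣ p c² and n ∤ c² for some prime p and some c.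
-- Given x₀, x₁, x₂, either p divides some xᵢ, or a pigeonhole count modulo p solves
-- i²x₀ + x₁ + j²x₂ ≡ 0 with 0 ≤ i, j < p; either way some consecutive block carries weights σ²
-- with p ∤ σ summing to 0 mod p, and the weights (cσ)² then lie in S(n)* and sum to 0 mod n.  Write n = 4ʳ m with m odd.  Taking u = 1 modulo 4ʳ and, modulo each odd prime
-- power q^f, u = -r for a quadratic non-residue r, the Chinese remainder theorem gives a unit u
-- such that s² + u t² ≡ 0 (mod n) forces s² ≡ 0.  Then the sequence (1, u) has no S(n)*-weighted
-- zero-sum, since any such sum has the form s² + u t² with s² or t² nonzero.
module Submission where

open import Defs
open import Data.Nat
open import Data.Nat.Properties
open import Data.Nat.Divisibility
open import Data.Nat.DivMod
open import Data.Nat.Primality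
  using (Prime; prime[2]; euclidsLemma; prime⇒irreducible; prime⇒nonTrivial; prime⇒nonZero)
open import Data.Nat.Primality.Factorisation using (factorise)
open import Data.Nat.Induction using (<-rec)
open import Data.Nat.Coprimality
  using (Coprime; coprime-divisor; coprime-Bézout; coprime-factors; 1-coprimeTo; coprime⇒gcd≡1)
open import Data.Nat.GCD using (module Bézout)
open import Data.Nat.LCM using (lcm; lcm-least; gcd*lcm)
open import Data.Nat.Tactic.RingSolver using (solve-∀)
open import Data.List using ([]; _∷_)
open import Data.List.Relation.Unary.All using (_∷_)
open import Data.Bool using (Bool; true; false; if_then_else_; _∧_)
open import Data.Bool.Properties using (T-≡; T-∧)
open import Data.Fin using (Fin; toℕ; fromℕ<) renaming (zero to fzero; suc to fsuc)
open import Data.Fin.Properties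
  using (pigeonhole; toℕ-fromℕ<; toℕ<n; any?; all?; ¬∀⟶∃¬; injective⇒≤; toℕ-injective)
open import Data.Product using (Σ; ∃-syntax; _×_; _,_; proj₁; proj₂)
open import Data.Sum using (_⊎_; inj₁; inj₂)
open import Function.Bundles using (_⇔_; mk⇔; module Equivalence)
open import Relation.Nullary using (¬_; Dec; yes; no; contradiction)
open import Relation.Binary.PropositionalEquality

mod-refl : ∀ {a n} → a ≡ a [mod n ]
mod-refl = 0 , 0 , refl

mod-sym : ∀ {a b n} → a ≡ b [mod n ] → b ≡ a [mod n ]
mod-sym (p , q , e) = q , p , sym e

mod-trans : ∀ {a b c n} → a ≡ b [mod n ] → b ≡ c [mod n ] → a ≡ c [mod n ]
mod-trans {a} {b} {c} {n} (p , q , e) (p′ , q′ , e′) = p + p′ , q + q′ , (begin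
  a + (p + p′) * n      ≡⟨ shift a p p′ n ⟩
  (a + p * n) + p′ * n  ≡⟨ cong (_+ p′ * n) e ⟩
  (b + q * n) + p′ * n  ≡⟨ swap b q p′ n ⟩
  (b + p′ * n) + q * n  ≡⟨ cong (_+ q * n) e′ ⟩
  (c + q′ * n) + q * n  ≡⟨ sym (shift′ c q′ q n) ⟩
  c + (q + q′) * n      ∎)
  where
  open ≡-Reasoning
  shift : ∀ a p p′ n → a + (p + p′) * n ≡ (a + p * n) + p′ * n
  shift = solve-∀
  swap : ∀ b q p′ n → (b + q * n) + p′ * n ≡ (b + p′ * n) + q * n
  swap = solve-∀
  shift′ : ∀ c q′ q n → c + (q + q′) * n ≡ (c + q′ * n) + q * n
  shift′ = solve-∀

mod-+ : ∀ {a b c d n} → a ≡ b [mod n ] → c ≡ d [mod n ] → (a + c) ≡ (b + d) [mod n ]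
mod-+ {a} {b} {c} {d} {n} (p , q , e) (r , s , e′) = p + r , q + s , (begin
  a + c + (p + r) * n        ≡⟨ regroup a c p r n ⟩
  (a + p * n) + (c + r * n)  ≡⟨ cong₂ _+_ e e′ ⟩
  (b + q * n) + (d + s * n)  ≡⟨ sym (regroup b d q s n) ⟩
  b + d + (q + s) * n        ∎)
  where
  open ≡-Reasoning
  regroup : ∀ a c p r n → a + c + (p + r) * n ≡ (a + p * n) + (c + r * n)
  regroup = solve-∀

mod-* : ∀ {a b c d n} → a ≡ b [mod n ] → c ≡ d [mod n ] → (a * c) ≡ (b * d) [mod n ]
mod-* {a} {b} {c} {d} {n} (p , q , e) (r , s , e′) =
  p * c + a * r + p * r * n , q * d + b * s + q * s * n , (begin
  a * c + (p * c + a * r + p * r * n) * n  ≡⟨ expand a c p r n ⟩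
  (a + p * n) * (c + r * n)                ≡⟨ cong₂ _*_ e e′ ⟩
  (b + q * n) * (d + s * n)                ≡⟨ sym (expand b d q s n) ⟩
  b * d + (q * d + b * s + q * s * n) * n  ∎)
  where
  open ≡-Reasoning
  expand : ∀ a c p r n → a * c + (p * c + a * r + p * r * n) * n ≡ (a + p * n) * (c + r * n)
  expand = solve-∀

mod-+-cancelˡ : ∀ {a c d n} → (a + c) ≡ (a + d) [mod n ] → c ≡ d [mod n ]
mod-+-cancelˡ {a} {c} {d} (p , q , e) =
  p , q , +-cancelˡ-≡ a _ _ (trans (sym (+-assoc a c _)) (trans e (+-assoc a d _)))

∣⇒≡0[mod] : ∀ {a n} → n ∣ a → a ≡ 0 [mod n ]
∣⇒≡0[mod] {a} (divides k e) = 0 , k , trans (+-identityʳ a) e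

≡0[mod]⇒∣ : ∀ {a n} → a ≡ 0 [mod n ] → n ∣ a
≡0[mod]⇒∣ {a} {n} (p , q , e) =
  ∣m+n∣m⇒∣n (subst (n ∣_) (trans (sym e) (+-comm a (p * n))) (n∣m*n q)) (n∣m*n p)

∣-resp-[mod] : ∀ {a b n} → a ≡ b [mod n ] → n ∣ a → n ∣ b
∣-resp-[mod] a≡b n∣a = ≡0[mod]⇒∣ (mod-trans (mod-sym a≡b) (∣⇒≡0[mod] n∣a))

m%n≡m[mod] : ∀ m n .{{_ : NonZero n}} → (m % n) ≡ m [mod n ]
m%n≡m[mod] m n = m / n , 0 , trans (sym (m≡m%n+[m/n]*n m n)) (sym (+-identityʳ m))

[mod]⇒%≡% : ∀ {a b n} .{{_ : NonZero n}} → a ≡ b [mod n ] → a % n ≡ b % n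
[mod]⇒%≡% {a} {b} {n} (p , q , e) =
  trans (sym ([m+kn]%n≡m%n a p n)) (trans (cong (_% n) e) ([m+kn]%n≡m%n b q n))

%≡%⇒[mod] : ∀ {a b n} .{{_ : NonZero n}} → a % n ≡ b % n → a ≡ b [mod n ]
%≡%⇒[mod] {a} {b} {n} e =
  mod-trans (mod-sym (m%n≡m[mod] a n)) (subst (_≡ b [mod n ]) (sym e) (m%n≡m[mod] b n))

prime⇒≥2 : ∀ {p} → Prime p → 2 ≤ p
prime⇒≥2 {p} pp = nonTrivial⇒n>1 p {{prime⇒nonTrivial pp}}

prime∤⇒coprime : ∀ {p s} → Prime p → ¬ p ∣ s → Coprime p s
prime∤⇒coprime pp p∤s (i∣p , i∣s) with prime⇒irreducible pp i∣p
... | inj₁ i≡1 = i≡1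
... | inj₂ refl = contradiction i∣s p∤s

prime∣²⇒∣ : ∀ {p s} → Prime p → p ∣ s * s → p ∣ s
prime∣²⇒∣ {s = s} pp p∣s² with euclidsLemma s s pp p∣s²
... | inj₁ p∣s = p∣s
... | inj₂ p∣s = p∣s

prime∤* : ∀ {p a b} → Prime p → ¬ p ∣ a → ¬ p ∣ b → ¬ p ∣ a * b
prime∤* {a = a} {b} pp p∤a p∤b p∣ab with euclidsLemma a b pp p∣ab
... | inj₁ p∣a = p∤a p∣a
... | inj₂ p∣b = p∤b p∣b

prime-factor : ∀ n → 2 ≤ n → ∃[ p ] ∃[ k ] (Prime p × n ≡ p * k)
prime-factor (suc zero) (s≤s ())
prime-factor (suc (suc m)) _ with factorise (suc (suc m))
... | record { factors = [] ; isFactorisation = () }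
... | record { factors = p ∷ _ ; isFactorisation = e ; factorsPrime = pp ∷ _ } = p , _ , pp , e

even-or-odd : ∀ n → ∃[ h ] (n ≡ h + h ⊎ n ≡ suc (h + h))
even-or-odd zero = 0 , inj₁ refl
even-or-odd (suc n) with even-or-odd n
... | h , inj₁ e = h , inj₂ (cong suc e)
... | h , inj₂ e = suc h , inj₁ (cong suc (trans e (sym (+-suc h h))))

halve : ∀ n → ∃[ h ] (h + h ≤ n × n ≤ suc (h + h))
halve n with even-or-odd n
... | h , inj₁ n≡2h = h , ≤-reflexive (sym n≡2h) , ≤-trans (≤-reflexive n≡2h) (n≤1+n _)
... | h , inj₂ n≡2h+1 = h , ≤-trans (n≤1+n _) (≤-reflexive (sym n≡2h+1)) , ≤-reflexive n≡2h+1

nonSquare⇒≥2 : ∀ {n} → ¬ IsPerfectSquare n → 2 ≤ n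
nonSquare⇒≥2 {0} ns = contradiction (0 , refl) ns
nonSquare⇒≥2 {1} ns = contradiction (1 , refl) ns
nonSquare⇒≥2 {suc (suc _)} _ = s≤s (s≤s z≤n)

record SquareDefect (n : ℕ) : Set where
  field
    c p : ℕ
    p-prime : Prime p
    n∣pc² : n ∣ p * (c * c)
    n∤c² : ¬ n ∣ c * c

nonSquare⇒squareDefect : ∀ n → ¬ IsPerfectSquare n → SquareDefect n
nonSquare⇒squareDefect = <-rec (λ n → ¬ IsPerfectSquare n → SquareDefect n) step
  where
  step : ∀ n → (∀ {m} → m < n → ¬ IsPerfectSquare m → SquareDefect m) →
         ¬ IsPerfectSquare n → SquareDefect n
  step n rec ns with prime-factor n (nonSquare⇒≥2 ns)
  ... | p , k , pp , n≡pk with p ∣? k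
  ...   | no p∤k = record
    { c = k ; p = p ; p-prime = pp
    ; n∣pc² = divides k (trans (regroup p k) (cong (k *_) (sym n≡pk)))
    ; n∤c² = λ n∣k² → p∤k (*-cancelˡ-∣ k {{k≢0}} (subst (_∣ k * k) (trans n≡pk (*-comm p k)) n∣k²))
    }
    where
    regroup : ∀ p k → p * (k * k) ≡ k * (p * k)
    regroup = solve-∀
    k≢0 : NonZero k
    k≢0 = ≢-nonZero λ { refl → ns (0 , sym (trans n≡pk (*-zeroʳ p))) }
  ...   | yes (divides j k≡jp) = record
    { c = p * c ; p = q ; p-prime = qq
    ; n∣pc² = subst₂ _∣_ (sym n≡p²j) (regroup₁ p q c) (*-monoʳ-∣ (p * p) j∣qc²)
    ; n∤c² = λ n∣p²c² →
        j∤c² (*-cancelˡ-∣ (p * p) {{p²≢0}} (subst₂ _∣_ n≡p²j (regroup₂ p c) n∣p²c²))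
    }
    where
    n≡p²j : n ≡ (p * p) * j
    n≡p²j = trans n≡pk (trans (cong (p *_) k≡jp) (regroup p j))
      where regroup : ∀ p j → p * (j * p) ≡ (p * p) * j
            regroup = solve-∀
    p²≢0 : NonZero (p * p)
    p²≢0 = m*n≢0 p p {{prime⇒nonZero pp}} {{prime⇒nonZero pp}}
    j-nonSquare : ¬ IsPerfectSquare j
    j-nonSquare (r , r²≡j) =
      ns (p * r , trans (regroup p r) (trans (cong ((p * p) *_) r²≡j) (sym n≡p²j)))
      where regroup : ∀ p r → (p * r) * (p * r) ≡ (p * p) * (r * r)
            regroup = solve-∀
    j≢0 : NonZero j
    j≢0 = ≢-nonZero λ { refl → j-nonSquare (0 , refl) }
    j<n : j < n
    j<n = subst (j <_) (trans (*-comm j (p * p)) (sym n≡p²j))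
            (m<m*n j (p * p) {{j≢0}} (≤-trans (prime⇒≥2 pp) (m≤m*n p p {{prime⇒nonZero pp}})))
    open SquareDefect (rec j<n j-nonSquare)
      renaming (p to q; p-prime to qq; n∣pc² to j∣qc²; n∤c² to j∤c²)
    regroup₁ : ∀ p q c → (p * p) * (q * (c * c)) ≡ q * ((p * c) * (p * c))
    regroup₁ = solve-∀
    regroup₂ : ∀ p c → (p * c) * (p * c) ≡ (p * p) * (c * c)
    regroup₂ = solve-∀

-- The equation i²x + y + j²z ≡ 0 (mod p)

0<m<p⇒p∤m : ∀ {m p} → 0 < m → m < p → ¬ p ∣ m
0<m<p⇒p∤m {suc _} _ m<p p∣m = <⇒≱ m<p (∣⇒≤ p∣m)

squares-distinct : ∀ {p x i j} → Prime p → ¬ p ∣ x → i < j → i + j < p →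
                   ¬ (i * i * x) ≡ (j * j * x) [mod p ]
squares-distinct {p} {x} {i} pp p∤x i<j i+j<p i²x≡j²x with m≤n⇒∃[o]m+o≡n i<j
... | d , refl = prime∤* pp (prime∤* pp p∤1+d p∤i+j) p∤x p∣difference
  where
  i+j = i + suc (i + d)
  p∤1+d : ¬ p ∣ suc d
  p∤1+d = 0<m<p⇒p∤m z<s (≤-<-trans (s≤s (m≤n+m d i)) (≤-<-trans (m≤n+m _ i) i+j<p))
  p∤i+j : ¬ p ∣ i+j
  p∤i+j = 0<m<p⇒p∤m (≤-trans z<s (m≤n+m _ i)) i+j<p
  difference : ∀ i d x → suc (i + d) * suc (i + d) * x ≡ i * i * x + suc d * (i + suc (i + d)) * x
  difference = solve-∀
  p∣difference : p ∣ suc d * i+j * x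
  p∣difference = ≡0[mod]⇒∣ (mod-sym (mod-+-cancelˡ
    (subst₂ (_≡_[mod p ]) (sym (+-identityʳ _)) (difference i d x) i²x≡j²x)))

-- Modulo suc p₀, multiplication by p₀ is negation.
neg-cancel[mod] : ∀ {p₀ a b} → (p₀ * a) ≡ (p₀ * b) [mod suc p₀ ] → a ≡ b [mod suc p₀ ]
neg-cancel[mod] {p₀} {a} {b} (k , l , e) = b + l , a + k ,
  trans (shuffleˡ p₀ a b l) (trans (cong (_+ (a + b)) (sym e)) (shuffleʳ p₀ a b k))
  where
  shuffleˡ : ∀ p₀ a b l → a + (b + l) * suc p₀ ≡ (p₀ * b + l * suc p₀) + (a + b)
  shuffleˡ = solve-∀
  shuffleʳ : ∀ p₀ a b k → (p₀ * a + k * suc p₀) + (a + b) ≡ b + (a + k) * suc p₀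
  shuffleʳ = solve-∀

≡neg[mod]⇒∣+ : ∀ {p₀ a b} → a ≡ (p₀ * b) [mod suc p₀ ] → suc p₀ ∣ a + b
≡neg[mod]⇒∣+ {p₀} {a} {b} a≡-b =
  ∣-resp-[mod] (mod-+ (mod-sym a≡-b) (mod-refl {b})) (divides b (factor p₀ b))
  where
  factor : ∀ p₀ b → p₀ * b + b ≡ b * suc p₀
  factor = solve-∀

-- The values i²x (i ≤ h) and -(y + j²z) (j ≤ p - h - 1) are p + 1 residues, so two coincide.
quadratic-solvable : ∀ {p x z} → Prime p → ¬ p ∣ x → ¬ p ∣ z → ∀ y →
                     ∃[ i ] ∃[ j ] (i < p × j < p × p ∣ i * i * x + y + j * j * z)
quadratic-solvable {zero} pp = contradiction (prime⇒≥2 pp) λ ()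
quadratic-solvable {p@(suc p₀)} {x} {z} pp p∤x p∤z y = collision (pigeonhole (n<1+n p) F)
  where
  h = proj₁ (halve p)
  2h≤p : h + h ≤ p
  2h≤p = proj₁ (proj₂ (halve p))
  p≤2h+1 : p ≤ suc (h + h)
  p≤2h+1 = proj₂ (proj₂ (halve p))
  value : ℕ → ℕ
  value k with k ≤? h
  ... | yes _ = k * k * x
  ... | no _ = p₀ * (y + (k ∸ suc h) * (k ∸ suc h) * z)
  F : Fin (suc p) → Fin p
  F k = fromℕ< (m%n<n (value (toℕ k)) p)
  meet : ∀ a b → a < b → b < suc p → value a ≡ value b [mod p ] →
         ∃[ i ] ∃[ j ] (i < p × j < p × p ∣ i * i * x + y + j * j * z)
  meet a b a<b b≤p a~b with a ≤? h | b ≤? h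
  ... | yes a≤h | yes b≤h = contradiction a~b
    (squares-distinct pp p∤x a<b (≤-trans (+-mono-<-≤ a<b b≤h) (≤-trans (+-monoˡ-≤ h b≤h) 2h≤p)))
  ... | no a≰h | yes b≤h = contradiction (≤-trans b≤h (<⇒≤ (≰⇒> a≰h))) (<⇒≱ a<b)
  ... | no a≰h | no b≰h = contradiction (mod-+-cancelˡ (neg-cancel[mod] a~b))
    (squares-distinct pp p∤z (∸-monoˡ-< a<b (≰⇒> a≰h))
      (≤-trans (+-mono-<-≤ (∸-monoˡ-< a<b (≰⇒> a≰h)) b′≤h) (≤-trans (+-monoˡ-≤ h b′≤h) 2h≤p)))
    where
    b′≤h : b ∸ suc h ≤ h
    b′≤h = m≤n+o⇒m∸n≤o b (suc h) (≤-trans (s≤s⁻¹ b≤p) p≤2h+1)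
  ... | yes a≤h | no b≰h = a , b′ , ≤-trans a<b (s≤s⁻¹ b≤p) , ≤-trans b′<b (s≤s⁻¹ b≤p) ,
    subst (p ∣_) (sym (+-assoc (a * a * x) y _)) (≡neg[mod]⇒∣+ a~b)
    where
    b′ = b ∸ suc h
    b′<b : b′ < b
    b′<b = subst (b′ <_) (m∸n+n≡m (≰⇒> b≰h)) (m<m+n b′ z<s)
  collision : ∃[ a ] ∃[ b ] (toℕ a < toℕ b × F a ≡ F b) →
              ∃[ i ] ∃[ j ] (i < p × j < p × p ∣ i * i * x + y + j * j * z)
  collision (a , b , a<b , Fa≡Fb) = meet (toℕ a) (toℕ b) a<b (toℕ<n b)
    (%≡%⇒[mod] (trans (sym (toℕ-fromℕ< _)) (trans (cong toℕ Fa≡Fb) (toℕ-fromℕ< _))))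

-- Zero sums on windows of the first three terms

triple : ℕ → ℕ → ℕ → ℕ → ℕ
triple a _ _ zero = a
triple _ b _ (suc zero) = b
triple _ _ c (suc (suc _)) = c

triple-all : ∀ {P : ℕ → Set} {a b c} → P a → P b → P c → ∀ j → P (triple a b c j)
triple-all pa pb pc zero = pa
triple-all pa pb pc (suc zero) = pb
triple-all pa pb pc (suc (suc _)) = pc

inWindow : ℕ → ℕ → ℕ → Bool
inWindow s e j = (s ≤ᵇ j) ∧ (j ≤ᵇ e)

select : Bool → ℕ → ℕ
select b v = if b then v else 0

windowSum : ℕ → ℕ → (ℕ → ℕ) → ℕ
windowSum s e f =
  select (inWindow s e 0) (f 0) + (select (inWindow s e 1) (f 1) + (select (inWindow s e 2) (f 2) + 0))

select-* : ∀ b k v → select b (k * v) ≡ k * select b v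
select-* false k v = sym (*-zeroʳ k)
select-* true k v = refl

windowSum-* : ∀ s e k f → windowSum s e (λ j → k * f j) ≡ k * windowSum s e f
windowSum-* s e k f = begin
  windowSum s e (λ j → k * f j)
    ≡⟨ cong₂ _+_ (select-* (w 0) k (f 0))
                 (cong₂ _+_ (select-* (w 1) k (f 1)) (cong (_+ 0) (select-* (w 2) k (f 2)))) ⟩
  k * t 0 + (k * t 1 + (k * t 2 + 0)) ≡⟨ distrib k (t 0) (t 1) (t 2) ⟩
  k * windowSum s e f                 ∎
  where
  open ≡-Reasoning
  w : ℕ → Bool
  w = inWindow s e
  t : ℕ → ℕ
  t j = select (w j) (f j)
  distrib : ∀ k a b c → k * a + (k * b + (k * c + 0)) ≡ k * (a + (b + (c + 0)))
  distrib = solve-∀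

windowSum-cong : ∀ s e {f g} → (∀ j → f j ≡ g j) → windowSum s e f ≡ windowSum s e g
windowSum-cong s e f≗g =
  cong₂ _+_ (cong (select (inWindow s e 0)) (f≗g 0))
    (cong₂ _+_ (cong (select (inWindow s e 1)) (f≗g 1))
      (cong (λ v → select (inWindow s e 2) v + 0) (f≗g 2)))

record ZeroSumWindow (m : ℕ) (x : ℕ → ℕ) : Set where
  field
    start end : ℕ
    start≤end : start ≤ end
    end≤2 : end ≤ 2
    root : ℕ → ℕ
    root²≢0 : ∀ j → ¬ m ∣ root j * root j
    m∣sum : m ∣ windowSum start end (λ j → root j * root j * x j)

module _ {p} (pp : Prime p) where

  p∤1² : ¬ p ∣ 1 * 1
  p∤1² p∣1 = <⇒≱ (prime⇒≥2 pp) (∣⇒≤ p∣1)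

  p∤unit² : ∀ {i} → i ≢ 0 → i < p → ¬ p ∣ i * i
  p∤unit² i≢0 i<p = prime∤* pp p∤i p∤i
    where p∤i = 0<m<p⇒p∤m (n≢0⇒n>0 i≢0) i<p

  triple-window : ∀ {x} s e → s ≤ e → e ≤ 2 → ∀ a b c → ¬ p ∣ a * a → ¬ p ∣ b * b → ¬ p ∣ c * c →
                  p ∣ windowSum s e (λ j → triple a b c j * triple a b c j * x j) → ZeroSumWindow p x
  triple-window s e s≤e e≤2 a b c p∤a² p∤b² p∤c² p∣sum = record
    { start = s ; end = e ; start≤end = s≤e ; end≤2 = e≤2 ; root = triple a b c
    ; root²≢0 = triple-all {P = λ r → ¬ p ∣ r * r} p∤a² p∤b² p∤c² ; m∣sum = p∣sum }

  prime-window : ∀ x₀ x₁ x₂ → ZeroSumWindow p (triple x₀ x₁ x₂)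
  prime-window x₀ x₁ x₂ with p ∣? x₀ | p ∣? x₂
  ... | yes p∣x₀ | _ =
    triple-window 0 0 z≤n z≤n 1 1 1 p∤1² p∤1² p∤1² (subst (p ∣_) (only₀ x₀) p∣x₀)
    where only₀ : ∀ x₀ → x₀ ≡ 1 * 1 * x₀ + (0 + (0 + 0))
          only₀ = solve-∀
  ... | no _ | yes p∣x₂ =
    triple-window 2 2 ≤-refl ≤-refl 1 1 1 p∤1² p∤1² p∤1² (subst (p ∣_) (only₂ x₂) p∣x₂)
    where only₂ : ∀ x₂ → x₂ ≡ 0 + (0 + (1 * 1 * x₂ + 0))
          only₂ = solve-∀
  ... | no p∤x₀ | no p∤x₂ with quadratic-solvable pp p∤x₀ p∤x₂ x₁
  ...   | i , j , i<p , j<p , p∣sum with i ≟ 0 | j ≟ 0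
  ...     | yes refl | yes refl =
    triple-window 1 1 ≤-refl (s≤s z≤n) 1 1 1 p∤1² p∤1² p∤1² (subst (p ∣_) (only₁ x₁ x₂) p∣sum)
    where only₁ : ∀ x₁ x₂ → 0 * 0 * x₀ + x₁ + 0 * 0 * x₂ ≡ 0 + (1 * 1 * x₁ + (0 + 0))
          only₁ = solve-∀
  ...     | no i≢0 | yes refl =
    triple-window 0 1 z≤n (s≤s z≤n) i 1 1 (p∤unit² i≢0 i<p) p∤1² p∤1²
      (subst (p ∣_) (first-two i x₀ x₁ x₂) p∣sum)
    where first-two : ∀ i x₀ x₁ x₂ →
                      i * i * x₀ + x₁ + 0 * 0 * x₂ ≡ i * i * x₀ + (1 * 1 * x₁ + (0 + 0))
          first-two = solve-∀
  ...     | yes refl | no j≢0 =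
    triple-window 1 2 (s≤s z≤n) ≤-refl 1 1 j p∤1² p∤1² (p∤unit² j≢0 j<p)
      (subst (p ∣_) (last-two j x₀ x₁ x₂) p∣sum)
    where last-two : ∀ j x₀ x₁ x₂ →
                     0 * 0 * x₀ + x₁ + j * j * x₂ ≡ 0 + (1 * 1 * x₁ + (j * j * x₂ + 0))
          last-two = solve-∀
  ...     | no i≢0 | no j≢0 =
    triple-window 0 2 z≤n ≤-refl i 1 j (p∤unit² i≢0 i<p) p∤1² (p∤unit² j≢0 j<p)
      (subst (p ∣_) (all-three i j x₀ x₁ x₂) p∣sum)
    where all-three : ∀ i j x₀ x₁ x₂ →
                      i * i * x₀ + x₁ + j * j * x₂ ≡ i * i * x₀ + (1 * 1 * x₁ + (j * j * x₂ + 0))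
          all-three = solve-∀

-- As n ∣ p c² and n ∤ c², p ∤ r forces n ∤ (c r)², while p ∣ S gives n ∣ c² S.
scale-window : ∀ {n x} (d : SquareDefect n) → ZeroSumWindow (SquareDefect.p d) x → ZeroSumWindow n x
scale-window {n} {x} d w = record
  { start = start ; end = end ; start≤end = start≤end ; end≤2 = end≤2
  ; root = λ j → c * root j ; root²≢0 = nonzero ; m∣sum = n∣sum }
  where
  open SquareDefect d
  open ZeroSumWindow w
  nonzero : ∀ j → ¬ n ∣ (c * root j) * (c * root j)
  nonzero j n∣ = n∤c² (coprime-factors (prime∤⇒coprime p-prime (root²≢0 j))
                        (n∣pc² , subst (n ∣_) (regroup c (root j)) n∣))
    where regroup : ∀ c r → (c * r) * (c * r) ≡ (r * r) * (c * c)
          regroup = solve-∀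
  n∣sum : n ∣ windowSum start end (λ j → (c * root j) * (c * root j) * x j)
  n∣sum = subst (n ∣_) (sym scaled)
    (∣-trans n∣pc² (subst (_∣ c * c * sum) (*-comm (c * c) p) (*-monoʳ-∣ (c * c) m∣sum)))
    where
    sum = windowSum start end (λ j → root j * root j * x j)
    regroup : ∀ c r x → (c * r) * (c * r) * x ≡ c * c * (r * r * x)
    regroup = solve-∀
    scaled : windowSum start end (λ j → (c * root j) * (c * root j) * x j) ≡
             c * c * sum
    scaled = trans (windowSum-cong start end (λ j → regroup c (root j) (x j)))
                   (windowSum-* start end (c * c) (λ j → root j * root j * x j))

inWindow⇔ : ∀ s e j → inWindow s e j ≡ true ⇔ (s ≤ j × j ≤ e)
inWindow⇔ s e j = mk⇔
  (λ w → let s≤ᵇj , j≤ᵇe = Equivalence.to T-∧ (Equivalence.from T-≡ w)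
         in ≤ᵇ⇒≤ s j s≤ᵇj , ≤ᵇ⇒≤ j e j≤ᵇe)
  (λ (s≤j , j≤e) → Equivalence.to T-≡ (Equivalence.from T-∧ (≤⇒≤ᵇ s≤j , ≤⇒≤ᵇ j≤e)))

firstThree : ∀ {n} → (Fin 3 → Fin n) → ℕ → ℕ
firstThree x = triple (toℕ (x fzero)) (toℕ (x (fsuc fzero))) (toℕ (x (fsuc (fsuc fzero))))

window⇒consecutiveZeroSum : ∀ {n} (x : Fin 3 → Fin n) → ZeroSumWindow n (firstThree x) →
  Σ (Fin 3 → Bool) λ I → Consecutive 3 I × WeightedZeroSumOn n 3 x I
window⇒consecutiveZeroSum x w =
  I , (start , end , λ i → inWindow⇔ start end (toℕ i)) ,
  (first , Equivalence.from (inWindow⇔ start end (toℕ first))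
             (≤-reflexive (sym toℕ-first) , ≤-trans (≤-reflexive toℕ-first) start≤end)) ,
  (λ i → root (toℕ i) * root (toℕ i)) ,
  (λ i _ → (root (toℕ i) , mod-refl) , λ root²≡0 → root²≢0 (toℕ i) (≡0[mod]⇒∣ root²≡0)) ,
  ∣⇒≡0[mod] m∣sum
  where
  open ZeroSumWindow w
  I : Fin 3 → Bool
  I i = inWindow start end (toℕ i)
  start<3 : start < 3
  start<3 = s≤s (≤-trans start≤end end≤2)
  first : Fin 3
  first = fromℕ< start<3
  toℕ-first : toℕ first ≡ start
  toℕ-first = toℕ-fromℕ< start<3

nonSquare⇒CProp₃ : ∀ {n} → ¬ IsPerfectSquare n → CProp n 3
nonSquare⇒CProp₃ {n} ns x = window⇒consecutiveZeroSum x (scale-window defect (prime-window p-prime _ _ _))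
  where
  defect = nonSquare⇒squareDefect n ns
  open SquareDefect defect using (p-prime)

-- Anisotropic residues

record Anisotropic (n u : ℕ) : Set where
  field
    form-zero : ∀ s t → n ∣ s * s + t * t * u → n ∣ s * s
    unit : ∀ b → n ∣ b * u → n ∣ b

anisotropic-resp : ∀ {n u v} → u ≡ v [mod n ] → Anisotropic n v → Anisotropic n u
anisotropic-resp u≡v a = record
  { form-zero = λ s t n∣ →
      form-zero s t (∣-resp-[mod] (mod-+ (mod-refl {s * s}) (mod-* (mod-refl {t * t}) u≡v)) n∣)
  ; unit = λ b n∣ → unit b (∣-resp-[mod] (mod-* (mod-refl {b}) u≡v) n∣)
  }
  where open Anisotropic a

coprime⇒*∣ : ∀ {m n o} → Coprime m n → m ∣ o → n ∣ o → m * n ∣ o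
coprime⇒*∣ {m} {n} {o} c m∣o n∣o = subst (_∣ o) lcm≡m*n (lcm-least m∣o n∣o)
  where
  lcm≡m*n : lcm m n ≡ m * n
  lcm≡m*n = trans (sym (*-identityˡ (lcm m n)))
                  (trans (cong (_* lcm m n) (sym (coprime⇒gcd≡1 c))) (gcd*lcm m n))

-- y b ≡ -1 (mod a), so its square is 1.
square≡1[mod] : ∀ {a b x y} → 1 + y * b ≡ x * a → ((y * b) * (y * b)) ≡ 1 [mod a ]
square≡1[mod] {a} {b} {x} {y} eq = 2 * x , x * x * a , (begin
  (y * b) * (y * b) + 2 * x * a      ≡⟨ cong ((y * b) * (y * b) +_) (*-assoc 2 x a) ⟩
  (y * b) * (y * b) + 2 * (x * a)    ≡⟨ cong (λ z → (y * b) * (y * b) + 2 * z) (sym eq) ⟩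
  (y * b) * (y * b) + 2 * (1 + y * b) ≡⟨ expand (y * b) ⟩
  1 + (1 + y * b) * (1 + y * b)      ≡⟨ cong (λ z → 1 + z * z) eq ⟩
  1 + (x * a) * (x * a)              ≡⟨ cong (1 +_) (regroup x a) ⟩
  1 + x * x * a * a                  ∎)
  where
  open ≡-Reasoning
  expand : ∀ z → z * z + 2 * (1 + z) ≡ 1 + (1 + z) * (1 + z)
  expand = solve-∀
  regroup : ∀ x a → (x * a) * (x * a) ≡ x * x * a * a
  regroup = solve-∀

-- With 1 + y b = x a, the residues (y b)² and x a are the idempotents of ℤ_a × ℤ_b.
chinese-remainder-Bézout : ∀ {a b x y} → 1 + y * b ≡ x * a →
  ∀ u v → ∃[ w ] (w ≡ u [mod a ] × w ≡ v [mod b ])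
chinese-remainder-Bézout {a} {b} {x} {y} eq u v = w ,
  subst (w ≡_[mod a ]) (cancel₁ u v)
    (mod-+ (mod-* (mod-refl {u}) (square≡1[mod] {a} {b} {x} {y} eq)) (mod-* (mod-refl {v}) xa≡0)) ,
  subst (w ≡_[mod b ]) (cancel₂ u v)
    (mod-+ (mod-* (mod-refl {u}) (∣⇒≡0[mod] b∣y²b²)) (mod-* (mod-refl {v}) xa≡1))
  where
  w = u * ((y * b) * (y * b)) + v * (x * a)
  xa≡0 : (x * a) ≡ 0 [mod a ]
  xa≡0 = ∣⇒≡0[mod] (n∣m*n x)
  b∣y²b² : b ∣ (y * b) * (y * b)
  b∣y²b² = ∣-trans (n∣m*n y) (m∣m*n (y * b))
  xa≡1 : (x * a) ≡ 1 [mod b ]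
  xa≡1 = 0 , y , trans (+-identityʳ (x * a)) (sym eq)
  cancel₁ : ∀ u v → u * 1 + v * 0 ≡ u
  cancel₁ = solve-∀
  cancel₂ : ∀ u v → u * 0 + v * 1 ≡ v
  cancel₂ = solve-∀

chinese-remainder : ∀ {a b} → Coprime a b → ∀ u v → ∃[ w ] (w ≡ u [mod a ] × w ≡ v [mod b ])
chinese-remainder c u v with coprime-Bézout c
... | Bézout.+- x y eq = chinese-remainder-Bézout {x = x} {y} eq u v
... | Bézout.-+ x y eq with w , w≡v , w≡u ← chinese-remainder-Bézout {x = y} {x} eq v u =
  w , w≡u , w≡v

anisotropic-* : ∀ {m n u v} → Coprime m n → Anisotropic m u → Anisotropic n v →
                ∃[ w ] Anisotropic (m * n) w
anisotropic-* {m} {n} {u} {v} c am an with w , w≡u , w≡v ← chinese-remainder c u v = w , record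
  { form-zero = λ s t mn∣ →
      coprime⇒*∣ c (A.form-zero s t (∣-trans (m∣m*n n) mn∣)) (B.form-zero s t (∣-trans (n∣m*n m) mn∣))
  ; unit = λ b mn∣ →
      coprime⇒*∣ c (A.unit b (∣-trans (m∣m*n n) mn∣)) (B.unit b (∣-trans (n∣m*n m) mn∣))
  }
  where
  module A = Anisotropic (anisotropic-resp w≡u am)
  module B = Anisotropic (anisotropic-resp w≡v an)

4∤k+4z : ∀ {k} → 0 < k → k < 4 → ∀ z → ¬ 4 ∣ k + 4 * z
4∤k+4z {k} 0<k k<4 z 4∣ =
  0<m<p⇒p∤m 0<k k<4 (∣m+n∣m⇒∣n (subst (4 ∣_) (+-comm k (4 * z)) 4∣) (m∣m*n z))

squares-even : ∀ s t → 4 ∣ s * s + t * t * 1 → ∃[ a ] ∃[ b ] (s ≡ a + a × t ≡ b + b)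
squares-even s t 4∣sum with even-or-odd s | even-or-odd t
... | a , inj₁ refl | b , inj₁ refl = a , b , refl , refl
... | a , inj₂ refl | b , inj₁ refl =
  contradiction (subst (4 ∣_) (odd-even a b) 4∣sum) (4∤k+4z z<s (s≤s (s≤s z≤n)) (a * a + a + b * b))
  where odd-even : ∀ a b → suc (a + a) * suc (a + a) + (b + b) * (b + b) * 1 ≡ 1 + 4 * (a * a + a + b * b)
        odd-even = solve-∀
... | a , inj₁ refl | b , inj₂ refl =
  contradiction (subst (4 ∣_) (even-odd a b) 4∣sum) (4∤k+4z z<s (s≤s (s≤s z≤n)) (a * a + b * b + b))
  where even-odd : ∀ a b → (a + a) * (a + a) + suc (b + b) * suc (b + b) * 1 ≡ 1 + 4 * (a * a + b * b + b)
        even-odd = solve-∀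
... | a , inj₂ refl | b , inj₂ refl =
  contradiction (subst (4 ∣_) (odd-odd a b) 4∣sum) (4∤k+4z z<s (s≤s (s≤s (s≤s z≤n))) (a * a + a + b * b + b))
  where odd-odd : ∀ a b → suc (a + a) * suc (a + a) + suc (b + b) * suc (b + b) * 1 ≡
                          2 + 4 * (a * a + a + b * b + b)
        odd-odd = solve-∀

anisotropic-4^ : ∀ r → Anisotropic (4 ^ r) 1
anisotropic-4^ r = record { form-zero = form-zero r ; unit = λ b → subst (4 ^ r ∣_) (*-identityʳ b) }
  where
  form-zero : ∀ r s t → 4 ^ r ∣ s * s + t * t * 1 → 4 ^ r ∣ s * s
  form-zero zero s t _ = 1∣ _
  form-zero (suc r) s t 4^r+1∣ with squares-even s t (m*n∣⇒m∣ 4 (4 ^ r) 4^r+1∣)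
  ... | a , b , refl , refl = subst (4 * 4 ^ r ∣_) (double a) (*-monoʳ-∣ 4 (form-zero r a b 4^r∣))
    where
    double : ∀ a → 4 * (a * a) ≡ (a + a) * (a + a)
    double = solve-∀
    double-sum : ∀ a b → (a + a) * (a + a) + (b + b) * (b + b) * 1 ≡ 4 * (a * a + b * b * 1)
    double-sum = solve-∀
    4^r∣ : 4 ^ r ∣ a * a + b * b * 1
    4^r∣ = *-cancelˡ-∣ 4 (subst (4 * 4 ^ r ∣_) (double-sum a b) 4^r+1∣)

coprime-*ˡ : ∀ {a b m} → Coprime a m → Coprime b m → Coprime (a * b) m
coprime-*ˡ ca cb (d∣ab , d∣m) =
  cb (coprime-divisor (λ (i∣d , i∣a) → ca (i∣a , ∣-trans i∣d d∣m)) d∣ab , d∣m)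

coprime-^ˡ : ∀ {q m} → Coprime q m → ∀ f → Coprime (q ^ f) m
coprime-^ˡ c zero = 1-coprimeTo _
coprime-^ˡ c (suc f) = coprime-*ˡ c (coprime-^ˡ c f)

anisotropic-prime^ : ∀ {q u} → Prime q → Anisotropic q u → ∀ f → Anisotropic (q ^ f) u
anisotropic-prime^ {q} {u} qq aq f = record
  { form-zero = form-zero f
  ; unit = λ b q^f∣bu →
      coprime-divisor (coprime-^ˡ (prime∤⇒coprime qq q∤u) f) (subst (q ^ f ∣_) (*-comm b u) q^f∣bu)
  }
  where
  open Anisotropic aq renaming (form-zero to form-zero₁; unit to unit₁)
  q∤u : ¬ q ∣ u
  q∤u q∣u = <⇒≱ (prime⇒≥2 qq) (∣⇒≤ (unit₁ 1 (subst (q ∣_) (sym (*-identityˡ u)) q∣u)))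
  form-zero : ∀ f s t → q ^ f ∣ s * s + t * t * u → q ^ f ∣ s * s
  form-zero zero s t _ = 1∣ _
  form-zero (suc zero) s t q∣ = subst (_∣ s * s) (sym (*-identityʳ q)) (form-zero₁ s t (m*n∣⇒m∣ q 1 q∣))
  form-zero (suc (suc f)) s t q^f+2∣
    with prime∣²⇒∣ {s = s} qq (form-zero₁ s t q∣sum) | prime∣²⇒∣ {s = t} qq q∣t²
    where
    q∣sum : q ∣ s * s + t * t * u
    q∣sum = m*n∣⇒m∣ q _ q^f+2∣
    q∣t² : q ∣ t * t
    q∣t² = unit₁ (t * t) (∣m+n∣m⇒∣n q∣sum (form-zero₁ s t q∣sum))
  ... | divides a refl | divides b refl =
    subst₂ _∣_ (*-assoc q q (q ^ f)) (regroup a q) (*-monoʳ-∣ (q * q) (form-zero f a b q^f∣))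
    where
    regroup : ∀ a q → (q * q) * (a * a) ≡ a * q * (a * q)
    regroup = solve-∀
    factor : ∀ a b q u → a * q * (a * q) + b * q * (b * q) * u ≡ (q * q) * (a * a + b * b * u)
    factor = solve-∀
    q^f∣ : q ^ f ∣ a * a + b * b * u
    q^f∣ = *-cancelˡ-∣ (q * q) {{m*n≢0 q q {{prime⇒nonZero qq}} {{prime⇒nonZero qq}}}}
             (subst₂ _∣_ (sym (*-assoc q q (q ^ f))) (factor a b q u) q^f+2∣)

square-inverse : ∀ {q t} → Coprime q t → ∃[ x ] ((x * t) * (x * t)) ≡ 1 [mod q ]
square-inverse {q} {t} c with coprime-Bézout c
... | Bézout.+- x y eq = y , square≡1[mod] {q} {t} {x} {y} eq
... | Bézout.-+ x y eq = y , mod-* yt≡1 yt≡1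
  where
  yt≡1 : (y * t) ≡ 1 [mod q ]
  yt≡1 = 0 , x , trans (+-identityʳ (y * t)) (sym eq)

module _ {h} (qq : Prime (suc (h + h))) where

  private
    q = suc (h + h)

  -- w and q - w have the same square.
  square-of-small : ∀ w → ∃[ v ] (v ≤ h × (w * w) ≡ (v * v) [mod suc (h + h) ])
  square-of-small w with w % q ≤? h
  ... | yes a≤h = w % q , a≤h , mod-* (mod-sym (m%n≡m[mod] w q)) (mod-sym (m%n≡m[mod] w q))
  ... | no a≰h = v , v≤h , mod-trans (mod-* (mod-sym (m%n≡m[mod] w q)) (mod-sym (m%n≡m[mod] w q))) a²≡v²
    where
    a = w % q
    v = q ∸ a
    v≤h : v ≤ h
    v≤h = m≤n+o⇒m∸n≤o q a (+-monoˡ-≤ h (≰⇒> a≰h))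
    v≤a : v ≤ a
    v≤a = ≤-trans v≤h (<⇒≤ (≰⇒> a≰h))
    v+a≡q : v + a ≡ q
    v+a≡q = m∸n+n≡m (<⇒≤ (m%n<n w q))
    d = a ∸ v
    a≡v+d : a ≡ v + d
    a≡v+d = sym (m+[n∸m]≡n v≤a)
    expand : ∀ v d → (v + d) * (v + d) ≡ v * v + d * (v + (v + d))
    expand = solve-∀
    a²≡v² : (a * a) ≡ (v * v) [mod q ]
    a²≡v² = 0 , d , (begin
      a * a + 0 * q            ≡⟨ +-identityʳ (a * a) ⟩
      a * a                    ≡⟨ cong (λ z → z * z) a≡v+d ⟩
      (v + d) * (v + d)        ≡⟨ expand v d ⟩
      v * v + d * (v + (v + d)) ≡⟨ cong (λ z → v * v + d * (v + z)) (sym a≡v+d) ⟩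
      v * v + d * (v + a)      ≡⟨ cong (λ z → v * v + d * z) v+a≡q ⟩
      v * v + d * q            ∎)
      where open ≡-Reasoning

  private
    IsSquare : Fin q → Set
    IsSquare r = ∃[ v ] ((toℕ {suc h} v * toℕ v) % q ≡ toℕ r)
    square? : ∀ r → Dec (IsSquare r)
    square? r = any? (λ v → (toℕ v * toℕ v) % q ≟ toℕ r)

  -- The h + 1 squares 0², …, h² cannot exhaust the 2h + 1 residues.
  nonresidue : ∃[ u ] (¬ suc (h + h) ∣ u × ∀ w → ¬ suc (h + h) ∣ u + w * w)
  nonresidue with all? square?
  ... | yes all-squares =
    contradiction (injective⇒≤ {f = λ r → proj₁ (all-squares r)} injective) (<⇒≱ h+1<q)
    where
    injective : ∀ {r r′} → proj₁ (all-squares r) ≡ proj₁ (all-squares r′) → r ≡ r′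
    injective {r} {r′} eq = toℕ-injective
      (trans (sym (proj₂ (all-squares r)))
             (trans (cong (λ v → (toℕ v * toℕ v) % q) eq) (proj₂ (all-squares r′))))
    h+1<q : suc h < q
    h+1<q = s≤s (≤-trans (≤-reflexive (+-comm 1 h)) (+-monoʳ-≤ h (h≥1 h qq)))
      where
      h≥1 : ∀ h → Prime (suc (h + h)) → 1 ≤ h
      h≥1 zero q=1 = contradiction (prime⇒≥2 q=1) λ { (s≤s ()) }
      h≥1 (suc _) _ = s≤s z≤n
  ... | no ¬all-squares with r , r-nonsquare ← ¬∀⟶∃¬ q IsSquare square? ¬all-squares =
    q ∸ toℕ r , 0<m<p⇒p∤m (m<n⇒0<n∸m (toℕ<n r)) (∸-monoʳ-< 0<r (<⇒≤ (toℕ<n r))) ,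
    λ w q∣u+w² → r-nonsquare (square-root w q∣u+w²)
    where
    u = q ∸ toℕ r
    u+r≡q : u + toℕ r ≡ q
    u+r≡q = m∸n+n≡m (<⇒≤ (toℕ<n r))
    square-root : ∀ w → q ∣ u + w * w → IsSquare r
    square-root w q∣u+w² with v , v≤h , w²≡v² ← square-of-small w =
      fromℕ< (s≤s v≤h) ,
      subst (λ z → (z * z) % q ≡ toℕ r) (sym (toℕ-fromℕ< (s≤s v≤h)))
            (trans ([mod]⇒%≡% v²≡r) (m<n⇒m%n≡m (toℕ<n r)))
      where
      w²≡r : (w * w) ≡ toℕ r [mod q ]
      w²≡r = mod-+-cancelˡ {u}
        (mod-trans (∣⇒≡0[mod] q∣u+w²) (mod-sym (∣⇒≡0[mod] (subst (q ∣_) (sym u+r≡q) ∣-refl))))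
      v²≡r : (v * v) ≡ toℕ r [mod q ]
      v²≡r = mod-trans (mod-sym w²≡v²) w²≡r
    0<r : 0 < toℕ r
    0<r = n≢0⇒n>0 λ r≡0 → r-nonsquare (fzero , sym r≡0)

  anisotropic-odd-prime : ∃[ u ] Anisotropic (suc (h + h)) u
  anisotropic-odd-prime with u , q∤u , nonres ← nonresidue =
    u , record { form-zero = form-zero ; unit = unit }
    where
    unit : ∀ b → q ∣ b * u → q ∣ b
    unit b q∣bu with euclidsLemma b u qq q∣bu
    ... | inj₁ q∣b = q∣b
    ... | inj₂ q∣u = contradiction q∣u q∤u
    form-zero : ∀ s t → q ∣ s * s + t * t * u → q ∣ s * s
    form-zero s t q∣ with q ∣? t
    ... | yes q∣t = ∣m+n∣m⇒∣n (subst (q ∣_) (+-comm (s * s) _) q∣) (∣m⇒∣m*n u (∣m⇒∣m*n t q∣t))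
    ... | no q∤t with x , xt²≡1 ← square-inverse (prime∤⇒coprime qq q∤t) =
      contradiction (∣-resp-[mod] scaled (∣n⇒∣m*n (x * x) q∣)) (nonres (x * s))
      where
      expand : ∀ x s t u → x * x * (s * s + t * t * u) ≡ (x * s) * (x * s) + (x * t) * (x * t) * u
      expand = solve-∀
      reorder : ∀ y u → y + 1 * u ≡ u + y
      reorder = solve-∀
      scaled : (x * x * (s * s + t * t * u)) ≡ (u + (x * s) * (x * s)) [mod q ]
      scaled = subst₂ (_≡_[mod q ]) (sym (expand x s t u)) (reorder ((x * s) * (x * s)) u)
                 (mod-+ (mod-refl {(x * s) * (x * s)}) (mod-* xt²≡1 (mod-refl {u})))

prime-power-split : ∀ {q} → Prime q → ∀ n → n ≢ 0 → ∃[ f ] ∃[ m ] (n ≡ q ^ f * m × ¬ q ∣ m)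
prime-power-split {q} qq = <-rec (λ n → n ≢ 0 → ∃[ f ] ∃[ m ] (n ≡ q ^ f * m × ¬ q ∣ m)) step
  where
  step : ∀ n → (∀ {k} → k < n → k ≢ 0 → ∃[ f ] ∃[ m ] (k ≡ q ^ f * m × ¬ q ∣ m)) →
         n ≢ 0 → ∃[ f ] ∃[ m ] (n ≡ q ^ f * m × ¬ q ∣ m)
  step n rec n≢0 with q ∣? n
  ... | no q∤n = 0 , n , sym (+-identityʳ n) , q∤n
  ... | yes (divides k n≡kq) = extend (rec k<n k≢0)
    where
    k≢0 : k ≢ 0
    k≢0 refl = n≢0 n≡kq
    k<n : k < n
    k<n = subst (k <_) (sym n≡kq) (m<m*n k q {{≢-nonZero k≢0}} (prime⇒≥2 qq))
    regroup : ∀ a m q → a * m * q ≡ q * a * m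
    regroup = solve-∀
    extend : ∃[ f ] ∃[ m ] (k ≡ q ^ f * m × ¬ q ∣ m) → ∃[ f ] ∃[ m ] (n ≡ q ^ f * m × ¬ q ∣ m)
    extend (f , m , k≡q^fm , q∤m) =
      suc f , m , trans n≡kq (trans (cong (_* q) k≡q^fm) (regroup (q ^ f) m q)) , q∤m

odd-split : ∀ n → 2 ≤ n → ¬ 2 ∣ n →
  ∃[ h ] ∃[ f ] ∃[ m ] (Prime (suc (h + h)) × n ≡ suc (h + h) ^ suc f * m × ¬ suc (h + h) ∣ m)
odd-split n 2≤n odd with q , k , qq , n≡qk ← prime-factor n 2≤n
  with prime-power-split qq k (λ { refl → <⇒≱ 2≤n (≤-trans (≤-reflexive (trans n≡qk (*-zeroʳ q))) z≤n) })
     | even-or-odd q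
... | _ | h , inj₁ refl =
  contradiction (∣-trans (divides h (double h)) (subst (h + h ∣_) (sym n≡qk) (m∣m*n k))) odd
  where double : ∀ h → h + h ≡ h * 2
        double = solve-∀
... | f , m , k≡q^fm , q∤m | h , inj₂ refl =
  h , f , m , qq ,
  trans n≡qk (trans (cong (suc (h + h) *_) k≡q^fm) (sym (*-assoc (suc (h + h)) (suc (h + h) ^ f) m))) , q∤m

anisotropic-odd : ∀ n → ¬ 2 ∣ n → ∃[ u ] Anisotropic n u
anisotropic-odd = <-rec (λ n → ¬ 2 ∣ n → ∃[ u ] Anisotropic n u) step
  where
  step : ∀ n → (∀ {m} → m < n → ¬ 2 ∣ m → ∃[ u ] Anisotropic m u) → ¬ 2 ∣ n → ∃[ u ] Anisotropic n u
  step 0 _ odd = contradiction (2 ∣0) odd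
  step 1 _ _ = 1 , record { form-zero = λ _ _ _ → 1∣ _ ; unit = λ _ _ → 1∣ _ }
  step n@(suc (suc _)) rec odd
    with h , f , m , qq , n≡q^f+1m , q∤m ← odd-split n (s≤s (s≤s z≤n)) odd =
    subst (λ n → ∃[ u ] Anisotropic n u) (sym n≡q^f+1m)
      (anisotropic-* (coprime-^ˡ (prime∤⇒coprime qq q∤m) (suc f))
                     (anisotropic-prime^ qq (proj₂ (anisotropic-odd-prime {h} qq)) (suc f))
                     (proj₂ (rec m<n m-odd)))
    where
    Q = suc (h + h) ^ suc f
    m-odd : ¬ 2 ∣ m
    m-odd 2∣m = odd (subst (2 ∣_) (sym n≡q^f+1m) (∣n⇒∣m*n Q 2∣m))
    m<n : m < n
    m<n = subst (m <_) (trans (*-comm m Q) (sym n≡q^f+1m))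
      (m<m*n m Q {{≢-nonZero λ { refl → 1+n≢0 (trans n≡q^f+1m (*-zeroʳ Q)) }}}
        (≤-trans (prime⇒≥2 qq) (m≤m*n (suc (h + h)) (suc (h + h) ^ f) {{m^n≢0 (suc (h + h)) f}})))

evenValuation⇒anisotropic : ∀ {n r} → V2Is n r → 2 ∣ r → ∃[ u ] Anisotropic n u
evenValuation⇒anisotropic {r = r} (divides m n≡m2^r , 2^r+1∤n) (divides r′ r≡r′2) =
  subst (λ n → ∃[ u ] Anisotropic n u) (sym (trans n≡m2^r (*-comm m (2 ^ r))))
    (anisotropic-* (coprime-^ˡ (prime∤⇒coprime prime[2] m-odd) r)
                   (subst (λ z → Anisotropic z 1) 4^r′≡2^r (anisotropic-4^ r′))
                   (proj₂ (anisotropic-odd m m-odd)))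
  where
  m-odd : ¬ 2 ∣ m
  m-odd (divides j m≡j2) =
    2^r+1∤n (divides j (trans n≡m2^r (trans (cong (_* 2 ^ r) m≡j2) (*-assoc j 2 (2 ^ r)))))
  4^r′≡2^r : 4 ^ r′ ≡ 2 ^ r
  4^r′≡2^r = trans (^-*-assoc 2 2 r′) (cong (2 ^_) (trans (*-comm 2 r′) (sym r≡r′2)))

-- Lower bound

DProp-suc : ∀ {n k} → DProp n k → DProp n (suc k)
DProp-suc D y with D (λ i → y (fsuc i))
... | I , (i , Ii) , a , a∈S* , zero-sum =
  (λ { fzero → false ; (fsuc i) → I i }) , (fsuc i , Ii) ,
  (λ { fzero → 0 ; (fsuc i) → a i }) , (λ { fzero () ; (fsuc i) → a∈S* i }) , zero-sum

select-*ʳ : ∀ b a x → select b (a * x) ≡ select b a * x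
select-*ʳ false a x = refl
select-*ʳ true a x = refl

select-square : ∀ {n a} b → (b ≡ true → InSstar n a) → ∃[ s ] (select b a ≡ (s * s) [mod n ])
select-square false _ = 0 , mod-refl
select-square true a∈S* = proj₁ (a∈S* refl)

-- With x = (1, u), the effective weights b_i = [i ∈ I] a_i are squares with b₀ + b₁ u ≡ 0, hence both vanish.
pair-no-zero-sum : ∀ {n} (x : Fin 2 → Fin n) → toℕ (x fzero) ≡ 1 → Anisotropic n (toℕ (x (fsuc fzero))) →
                   ∀ I → ¬ WeightedZeroSumOn n 2 x I
pair-no-zero-sum {n} x x₀≡1 an I ((i , Ii) , a , a∈S* , zero-sum) =
  proj₂ (a∈S* i Ii) (∣⇒≡0[mod] (subst (λ c → n ∣ select c (a i)) Ii (n∣b i)))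
  where
  open Anisotropic an
  i₀ i₁ : Fin 2
  i₀ = fzero
  i₁ = fsuc fzero
  u = toℕ (x i₁)
  b : Fin 2 → ℕ
  b i = select (I i) (a i)
  b-square : ∀ i → ∃[ s ] (b i ≡ (s * s) [mod n ])
  b-square i = select-square (I i) (a∈S* i)
  n∣b₀+b₁u : n ∣ b i₀ + b i₁ * u
  n∣b₀+b₁u = subst (n ∣_) sum≡ (≡0[mod]⇒∣ zero-sum)
    where
    tidy : ∀ c d → c * 1 + (d + 0) ≡ c + d
    tidy = solve-∀
    sum≡ : select (I i₀) (a i₀ * toℕ (x i₀)) + (select (I i₁) (a i₁ * u) + 0) ≡ b i₀ + b i₁ * u
    sum≡ = trans (cong₂ (λ c d → c + (d + 0))
                        (trans (select-*ʳ (I i₀) (a i₀) _) (cong (b i₀ *_) x₀≡1))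
                        (select-*ʳ (I i₁) (a i₁) u))
                 (tidy (b i₀) (b i₁ * u))
  n∣b₀ : n ∣ b i₀
  n∣b₀ with s₀ , b₀≡s₀² ← b-square i₀ | s₁ , b₁≡s₁² ← b-square i₁ =
    ∣-resp-[mod] (mod-sym b₀≡s₀²)
      (form-zero s₀ s₁ (∣-resp-[mod] (mod-+ b₀≡s₀² (mod-* b₁≡s₁² mod-refl)) n∣b₀+b₁u))
  n∣b : ∀ i → n ∣ b i
  n∣b fzero = n∣b₀
  n∣b (fsuc fzero) = unit (b i₁) (∣m+n∣m⇒∣n n∣b₀+b₁u n∣b₀)

anisotropic⇒¬DProp₂ : ∀ {n u} → 2 ≤ n → Anisotropic n u → ¬ DProp n 2
anisotropic⇒¬DProp₂ {n@(suc (suc _))} {u} (s≤s (s≤s z≤n)) an D =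
  pair-no-zero-sum x refl (anisotropic-resp x₁≡u an) (proj₁ (D x)) (proj₂ (D x))
  where
  x : Fin 2 → Fin n
  x fzero = fsuc fzero
  x (fsuc _) = fromℕ< (m%n<n u n)
  x₁≡u : toℕ (x (fsuc fzero)) ≡ u [mod n ]
  x₁≡u = subst (_≡ u [mod n ]) (sym (toℕ-fromℕ< (m%n<n u n))) (m%n≡m[mod] u n)

¬DProp₂⇒least : ∀ {n} → ¬ DProp n 2 → ∀ k → 1 ≤ k → DProp n k → 3 ≤ k
¬DProp₂⇒least ¬D₂ 1 _ D₁ = contradiction (DProp-suc D₁) ¬D₂
¬DProp₂⇒least ¬D₂ 2 _ D₂ = contradiction D₂ ¬D₂
¬DProp₂⇒least ¬D₂ (suc (suc (suc _))) _ _ = s≤s (s≤s (s≤s z≤n))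

CProp⇒DProp : ∀ {n k} → CProp n k → DProp n k
CProp⇒DProp C x = proj₁ (C x) , proj₂ (proj₂ (C x))

corollary6 : (n : ℕ) → ¬ IsPerfectSquare n → (r : ℕ) → V2Is n r → 2 ∣ r →
    D-Sstar-is n 3 × C-Sstar-is n 3
corollary6 n ns r v₂ 2∣r =
  (s≤s z≤n , CProp⇒DProp C₃ , least) ,
  (s≤s z≤n , C₃ , λ k 1≤k Cₖ → least k 1≤k (CProp⇒DProp Cₖ))
  where
  C₃ : CProp n 3
  C₃ = nonSquare⇒CProp₃ ns
  least : ∀ k → 1 ≤ k → DProp n k → 3 ≤ k
  least = ¬DProp₂⇒least (anisotropic⇒¬DProp₂ (nonSquare⇒≥2 ns) (proj₂ (evenValuation⇒anisotropic v₂ 2∣r)))
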